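{- Let $V$ be a set and $X$ a set of tournaments on $V$. If the profile of $X$ with respect to some $\ell\in X$ is minimal, then its profile with respect to any other $\ell'\in X$ is minimal too.
   Context: $\Delta_V:=\{(x,x):x\in V\}$. A tournament on $V$ is an irreflexive binary relation $\tau$ on $V$ such that for distinct $x,y$ exactly one of $(x,y),(y,x)$ lies in $\tau$; $\tau(x,y)=1$ if $(x,y)\in\tau$ and $0$ otherwise. For $(x,y)\in V\times V\setminus\Delta_V$, $p_X(x,y):=(\tau(x,y))_{\tau\in X}$. The profile of $X$ with respect to $\ell\in X$ is $\{p_X(x,y):(x,y)\in\ell\}$; it is minimal if $p_X(x,y)\neq p_X(x',y')$ for any two distinct ordered pairs $(x,y),(x',y')\in\ell$. -}

module Defs where

open import Data.Bool using (Bool; true; false)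
open import Data.Product using (_×_)
open import Data.Sum using (_⊎_)
open import Relation.Binary.PropositionalEquality using (_≡_)
open import Relation.Nullary using (¬_)

-- A binary relation on V is given by its characteristic function
-- rel x y = true  iff (x , y) ∈ τ   (i.e. τ(x,y) = 1).
record Tournament (V : Set) : Set where
  field
    rel        : V → V → Bool
    irrefl     : ∀ x → rel x x ≡ false
    atLeastOne : ∀ x y → ¬ (x ≡ y) → (rel x y ≡ true ⊎ rel y x ≡ true)
    atMostOne  : ∀ x y → ¬ (x ≡ y) → ¬ (rel x y ≡ true × rel y x ≡ true)

open Tournament public

-- A set X of tournaments on V is a predicate on tournaments.
-- p_X(x,y) = (τ(x,y))_{τ ∈ X}; two such X-indexed tuples are equal
-- iff they agree at every coordinate τ ∈ X.
SameP : {V : Set} → (Tournament V → Set) → V → V → V → V → Set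
SameP X x y x' y' = ∀ τ → X τ → rel τ x y ≡ rel τ x' y'

MinimalProfile : {V : Set} → (Tournament V → Set) → Tournament V → Set
MinimalProfile X ℓ =
  ∀ x y x' y' → rel ℓ x y ≡ true → rel ℓ x' y' ≡ true →
  ¬ (x ≡ x' × y ≡ y') → ¬ SameP X x y x' y'

-- In a tournament the two orientations of a pair of distinct vertices carry
-- complementary values, so p_X(y,x) is the coordinatewise negation of
-- p_X(x,y). Given a coincidence p_X(x,y) = p_X(x',y') between distinct arcs
-- of ℓ', the coordinate ℓ shows that either both arcs lie in ℓ or both
-- reversed arcs do; either way minimality for ℓ is contradicted.
module Submission where

open import Defs
open import Data.Bool using (true; false; not)
open import Data.Product using (_×_; _,_)
open import Data.Sum using (inj₁; inj₂)
open import Relation.Binary.PropositionalEquality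

module _ {V : Set} where

  rel⇒≢ : (τ : Tournament V) {x y : V} → rel τ x y ≡ true → x ≢ y
  rel⇒≢ τ {x} τxy refl with () ← trans (sym τxy) (irrefl τ x)

  rel-flip : (τ : Tournament V) {x y : V} → x ≢ y → rel τ y x ≡ not (rel τ x y)
  rel-flip τ {x} {y} x≢y with rel τ x y in τxy | rel τ y x in τyx
  ... | true  | true  with () ← atMostOne τ x y x≢y (τxy , τyx)
  ... | true  | false = refl
  ... | false | true  = refl
  ... | false | false with atLeastOne τ x y x≢y
  ...   | inj₁ p with () ← trans (sym τxy) p
  ...   | inj₂ p with () ← trans (sym τyx) p

  rel-reverse : (τ : Tournament V) {x y : V} → x ≢ y → rel τ x y ≡ false → rel τ y x ≡ true
  rel-reverse τ x≢y τxy = trans (rel-flip τ x≢y) (cong not τxy)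

  SameP-reverse : (X : Tournament V → Set) {x y x' y' : V} → x ≢ y → x' ≢ y' →
    SameP X x y x' y' → SameP X y x y' x'
  SameP-reverse X {x} {y} {x'} {y'} x≢y x'≢y' same τ Xτ = begin
    rel τ y x         ≡⟨ rel-flip τ x≢y ⟩
    not (rel τ x y)   ≡⟨ cong not (same τ Xτ) ⟩
    not (rel τ x' y') ≡⟨ sym (rel-flip τ x'≢y') ⟩
    rel τ y' x'       ∎
    where open ≡-Reasoning

corollary1 : {V : Set} (X : Tournament V → Set) (ℓ ℓ' : Tournament V) →
    X ℓ → X ℓ' → MinimalProfile X ℓ → MinimalProfile X ℓ'
corollary1 X ℓ ℓ' Xℓ _ minℓ x y x' y' ℓ'xy ℓ'x'y' distinct same
  with rel ℓ x y in ℓxy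
... | true  = minℓ x y x' y' ℓxy (trans (sym (same ℓ Xℓ)) ℓxy) distinct same
... | false = minℓ y x y' x'
  (rel-reverse ℓ x≢y ℓxy)
  (rel-reverse ℓ x'≢y' (trans (sym (same ℓ Xℓ)) ℓxy))
  (λ (y≡y' , x≡x') → distinct (x≡x' , y≡y'))
  (SameP-reverse X x≢y x'≢y' same)
  where
  x≢y   = rel⇒≢ ℓ' ℓ'xy
  x'≢y' = rel⇒≢ ℓ' ℓ'x'y'
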